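{- For all positive integers $m\le n$, the double path $\overrightarrow{P}_{n,[m]}$ (vertex set $[n]=\{1,\dots,n\}$, loops exactly at the vertices $1,\dots,m$) requires the nSSP.
   Context: A digraph $G$ has vertex set $V(G)=[n]$ and arc set $E(G)\subseteq [n]\times[n]$; arcs $(v,v)$ are loops. $\mathcal M(G)$ is the set of real $n\times n$ matrices $A=(a_{ij})$ with $a_{ij}\neq 0$ if and only if $(i,j)\in E(G)$. A real $n\times n$ matrix $A$ has the non-symmetric Strong Spectral Property (nSSP) if the only real matrix $X$ with $A\circ X=O$ (entrywise product) and $AX^\top-X^\top A=O$ is $X=O$. A digraph $G$ requires the nSSP if every $A\in\mathcal M(G)$ has the nSSP, and allows the nSSP if some $A\in\mathcal M(G)$ has it. For $\mathcal L\subseteq[n]$, the double path $\overrightarrow{P}_{n,\mathcal L}$ has vertex set $[n]$ and arc set $\{(i,i+1),(i+1,i): i\in[n-1]\}\cup\{(\ell,\ell):\ell\in\mathcal L\}$ (so $\mathcal M(\overrightarrow{P}_{n,\mathcal L})$ consists of irreducible tridiagonal matrices whose nonzero diagonal entries are exactly in positions $\mathcal L$). -}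

module Defs where

open import Level using (0ℓ)
open import Data.Nat as ℕ using (ℕ; zero; suc)
open import Data.Fin using (Fin; toℕ)
open import Data.Product using (Σ; ∃; _×_; _,_)
open import Data.Sum using (_⊎_)
open import Relation.Nullary using (¬_)
open import Relation.Binary.PropositionalEquality using (_≡_)
open import Relation.Binary.Structures using (IsStrictTotalOrder)
open import Algebra.Structures using (IsCommutativeRing)

-- The real numbers, axiomatised as a complete ordered field
-- (agda-stdlib has no reals).  Any two such structures are isomorphic
-- (classically), so quantifying over all of them means "over ℝ".

record RealField : Set₁ where
  infixl 7 _*_
  infixl 6 _+_
  infix  4 _≈_ _<_ _≤_
  field
    Carrier : Set
    _≈_     : Carrier → Carrier → Set
    _+_     : Carrier → Carrier → Carrier
    _*_     : Carrier → Carrier → Carrier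
    -_      : Carrier → Carrier
    0#      : Carrier
    1#      : Carrier
    isCommutativeRing : IsCommutativeRing _≈_ _+_ _*_ -_ 0# 1#
    1≉0     : ¬ (1# ≈ 0#)
    inverse : ∀ x → ¬ (x ≈ 0#) → ∃ λ y → x * y ≈ 1#
    _<_     : Carrier → Carrier → Set
    isStrictTotalOrder : IsStrictTotalOrder _≈_ _<_
    +-mono-< : ∀ x y z → x < y → x + z < y + z
    *-pos    : ∀ x y → 0# < x → 0# < y → 0# < x * y

  _≤_ : Carrier → Carrier → Set
  x ≤ y = x < y ⊎ x ≈ y

  field
    complete : (P : Carrier → Set) → (∃ λ x → P x) →
               (∃ λ b → ∀ x → P x → x ≤ b) →
               ∃ λ s → (∀ x → P x → x ≤ s) ×
                       (∀ b → (∀ x → P x → x ≤ b) → s ≤ b)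

-- Matrices over ℝ, indexed by Fin n (vertex i+1 of the paper is i : Fin n)

module _ (ℝ : RealField) where
  open RealField ℝ

  Matrix : ℕ → Set
  Matrix n = Fin n → Fin n → Carrier

  sumFin : ∀ n → (Fin n → Carrier) → Carrier
  sumFin zero    f = 0#
  sumFin (suc n) f = f Fin.zero + sumFin n (λ k → f (Fin.suc k))


  -- non-symmetric Strong Spectral Property:
  -- A ∘ X = O and A Xᵀ − Xᵀ A = O imply X = O
  nSSP : ∀ {n} → Matrix n → Set
  nSSP {n} A =
    (X : Matrix n) →
    (∀ i j → A i j * X i j ≈ 0#) →
    (∀ i j → sumFin n (λ k → A i k * X j k) ≈ sumFin n (λ k → X k i * A k j)) →
    ∀ i j → X i j ≈ 0#

  InM : ∀ {n} → (Fin n → Fin n → Set) → Matrix n → Set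
  InM {n} Arc A = ∀ i j → (¬ (A i j ≈ 0#) → Arc i j) × (Arc i j → ¬ (A i j ≈ 0#))

-- Arcs of the double path P_{n,[m]}: (i,i+1), (i+1,i), and loops (ℓ,ℓ) for
-- the vertices ℓ ∈ {1,…,m} of the paper, i.e. toℕ ℓ < m here (0-based).
DoublePathArc : ∀ {n} (m : ℕ) → Fin n → Fin n → Set
DoublePathArc m i j =
  (suc (toℕ i) ≡ toℕ j) ⊎ (toℕ i ≡ suc (toℕ j)) ⊎ ((toℕ i ≡ toℕ j) × (toℕ i ℕ.< m))

module Submission where

-- Put y = Xᵀ (indices are 0-based, so the loops sit at 0, …, ℓ = m - 1).  Then a y = y a, and y
-- vanishes wherever aᵀ does not: on the superdiagonal and on the first m diagonal entries.  As a
-- is tridiagonal, the (i, j) entry of a y = y a has at most three terms on each side.  Since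
-- a (i, i+1) ≠ 0, that entry determines row i+1 of y from rows i-1 and i, so y = 0 once its first
-- row vanishes, which follows from y vanishing on the triangle i + j < n.  This is proved one
-- antidiagonal at a time: when all entries with i + j < s vanish, the entries on i + j = s satisfy
-- a (i, i+1) y (i+1, j) = y (i, j+1) a (j+1, j), so they all vanish as soon as one does.  Odd
-- antidiagonals meet the superdiagonal, and the antidiagonal 2k meets a loop at (k, k) when k ≤ ℓ.
-- Otherwise we use the row ℓ of the last loop: in the loopless rows k ≥ ℓ the odd superdiagonals
-- y (k, k + 2r + 1) vanish (by downward induction on k), and then the (ℓ, q) entry of a y = y a
-- collapses to a (ℓ, ℓ) y (ℓ, q) = 0.

open import Defs
open import Data.Nat using (ℕ; _≤_)

open import Data.Nat using (zero; suc; _+_; _<_; z≤n; s≤s; _<?_; _≤?_)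
open import Data.Nat.Properties
  using (≤-refl; ≤-reflexive; ≤-trans; <-trans; ≤-<-trans; <-≤-trans; <⇒≤; <⇒≱; ≰⇒>; ≮⇒≥; n≤1+n; n<1+n;
         m≤n⇒m≤1+n; m<n⇒m<1+n; m≤m+n; m≤n+m; m≤n⇒m<n∨m≡n; m≤n⇒∃[o]m+o≡n; +-suc; +-monoʳ-≤; +-monoˡ-<;
         +-monoʳ-<; 1+n≢n)
open import Data.Nat.Tactic.RingSolver using (solve-∀)
open import Data.Fin using (Fin; toℕ; fromℕ<)
open import Data.Fin.Properties using (toℕ-fromℕ<; toℕ<n)
open import Data.Product using (∃; ∃₂; _×_; _,_; proj₁; proj₂)
open import Data.Sum using (_⊎_; inj₁; inj₂)
open import Data.Empty using (⊥-elim)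
open import Function using (flip; _∘_)
open import Function.Bundles using (_⇔_; mk⇔; Equivalence)
open import Relation.Nullary using (¬_; yes; no)
open import Relation.Nullary.Decidable using (decidable-stable)
open import Relation.Binary.PropositionalEquality as ≡ using (_≡_)
open import Relation.Binary.Structures using (IsStrictTotalOrder)
open import Algebra.Structures using (IsCommutativeRing)

PathArc : ℕ → ℕ → ℕ → Set
PathArc m i k = (suc i ≡ k) ⊎ (i ≡ suc k) ⊎ ((i ≡ k) × (i < m))

PathArc⇒adjacent : ∀ {m i k} → PathArc m i k → i ≤ suc k × k ≤ suc i
PathArc⇒adjacent {i = i} (inj₁ ≡.refl)                = m≤n⇒m≤1+n (n≤1+n i) , ≤-refl
PathArc⇒adjacent {k = k} (inj₂ (inj₁ ≡.refl))         = ≤-refl , m≤n⇒m≤1+n (n≤1+n k)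
PathArc⇒adjacent {i = i} (inj₂ (inj₂ (≡.refl , _))) = n≤1+n i , n≤1+n i

far⇒¬PathArc : ∀ {m i k} → suc k < i ⊎ suc i < k → ¬ PathArc m i k
far⇒¬PathArc (inj₁ k+1<i) arc = <⇒≱ k+1<i (proj₁ (PathArc⇒adjacent arc))
far⇒¬PathArc (inj₂ i+1<k) arc = <⇒≱ i+1<k (proj₂ (PathArc⇒adjacent arc))

¬PathArc-loop : ∀ {m i} → m ≤ i → ¬ PathArc m i i
¬PathArc-loop m≤i (inj₁ e)                = 1+n≢n e
¬PathArc-loop m≤i (inj₂ (inj₁ e))         = 1+n≢n (≡.sym e)
¬PathArc-loop m≤i (inj₂ (inj₂ (_ , i<m))) = <⇒≱ i<m m≤i

data OddGap : ℕ → ℕ → Set where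
  gap₁  : ∀ {i} → OddGap i (suc i)
  gap₊₂ : ∀ {i j} → OddGap i j → OddGap i (suc (suc j))

OddGap⇒< : ∀ {i j} → OddGap i j → i < j
OddGap⇒< gap₁      = ≤-refl
OddGap⇒< (gap₊₂ g) = m≤n⇒m≤1+n (m≤n⇒m≤1+n (OddGap⇒< g))

OddGap-suc : ∀ {i j} → OddGap i j → OddGap (suc i) (suc j)
OddGap-suc gap₁      = gap₁
OddGap-suc (gap₊₂ g) = gap₊₂ (OddGap-suc g)

OddGap-sucˡ⇒sucʳ : ∀ {i j} → OddGap (suc i) j → OddGap i (suc j)
OddGap-sucˡ⇒sucʳ gap₁      = gap₊₂ gap₁
OddGap-sucˡ⇒sucʳ (gap₊₂ g) = gap₊₂ (OddGap-sucˡ⇒sucʳ g)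

OddGap-double : ∀ i d → OddGap i (d + d + suc i)
OddGap-double i zero    = gap₁
OddGap-double i (suc d) rewrite +-suc d d = gap₊₂ (OddGap-double i d)

even-split-OddGap : ∀ ℓ k → ℓ < k → ∃ λ q → ℓ + q ≡ k + k × OddGap (suc ℓ) q
even-split-OddGap ℓ k ℓ<k with m≤n⇒∃[o]m+o≡n ℓ<k
... | d , ≡.refl = d + d + suc (suc ℓ) , sum-identity ℓ d , OddGap-double (suc ℓ) d
  where
  sum-identity : ∀ ℓ d → ℓ + (d + d + suc (suc ℓ)) ≡ (suc ℓ + d) + (suc ℓ + d)
  sum-identity = solve-∀

halve : ∀ s → ∃ λ k → (k + k ≡ s) ⊎ (suc (k + k) ≡ s)
halve zero = 0 , inj₁ ≡.refl
halve (suc s) with halve s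
... | k , inj₁ ≡.refl = k , inj₂ ≡.refl
... | k , inj₂ ≡.refl = suc k , inj₁ (≡.cong suc (+-suc k k))

module _ (ℝ : RealField) where
  open RealField ℝ using (Carrier; _≈_; _*_; 0#; 1#; inverse; isCommutativeRing; isStrictTotalOrder)
    renaming (_+_ to _+ᴿ_)
  open IsCommutativeRing isCommutativeRing
    using (setoid; sym; trans; reflexive; +-cong; +-congˡ; +-congʳ; +-assoc; +-identityˡ; +-identityʳ;
           *-congˡ; *-congʳ; *-cong; *-assoc; *-comm; *-identityˡ; zeroˡ; zeroʳ)
    renaming (refl to ≈-refl)
  open IsStrictTotalOrder isStrictTotalOrder using (_≟_)
  open import Relation.Binary.Reasoning.Setoid setoid

  ≈0-stable : ∀ x → ¬ ¬ x ≈ 0# → x ≈ 0#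
  ≈0-stable x = decidable-stable (x ≟ 0#)

  x≈0⇒x*y≈0 : ∀ {x y} → x ≈ 0# → x * y ≈ 0#
  x≈0⇒x*y≈0 x≈0 = trans (*-congʳ x≈0) (zeroˡ _)

  y≈0⇒x*y≈0 : ∀ {x y} → y ≈ 0# → x * y ≈ 0#
  y≈0⇒x*y≈0 y≈0 = trans (*-congˡ y≈0) (zeroʳ _)

  x*y≈0⇒y≈0 : ∀ {x y} → ¬ x ≈ 0# → x * y ≈ 0# → y ≈ 0#
  x*y≈0⇒y≈0 {x} {y} x≉0 xy≈0 with inverse x x≉0
  ... | x⁻¹ , xx⁻¹≈1 = begin
    y              ≈⟨ *-identityˡ y ⟨
    1# * y         ≈⟨ *-congʳ (trans (*-comm x⁻¹ x) xx⁻¹≈1) ⟨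
    x⁻¹ * x * y    ≈⟨ *-assoc x⁻¹ x y ⟩
    x⁻¹ * (x * y)  ≈⟨ y≈0⇒x*y≈0 xy≈0 ⟩
    0#             ∎

  x*y≈0⇒x≈0 : ∀ {x y} → ¬ y ≈ 0# → x * y ≈ 0# → x ≈ 0#
  x*y≈0⇒x≈0 {x} {y} y≉0 xy≈0 = x*y≈0⇒y≈0 y≉0 (trans (*-comm y x) xy≈0)

  sumFin-cong : ∀ N {f g : Fin N → Carrier} → (∀ k → f k ≈ g k) → sumFin ℝ N f ≈ sumFin ℝ N g
  sumFin-cong zero    f≈g = ≈-refl
  sumFin-cong (suc N) f≈g = +-cong (f≈g Fin.zero) (sumFin-cong N (f≈g ∘ Fin.suc))

  ∑ : ℕ → (ℕ → Carrier) → Carrier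
  ∑ N h = sumFin ℝ N (λ k → h (toℕ k))

  before : ℕ → (ℕ → Carrier) → Carrier
  before zero    h = 0#
  before (suc c) h = h c

  neighbourSum : ℕ → (ℕ → Carrier) → Carrier
  neighbourSum c h = before c h +ᴿ h c +ᴿ h (suc c)

  before≈0 : ∀ c h → (∀ k → suc k ≡ c → h k ≈ 0#) → before c h ≈ 0#
  before≈0 zero    h _   = ≈-refl
  before≈0 (suc c) h h≈0 = h≈0 c ≡.refl

  neighbourSum≈0 : ∀ c h → (∀ k → suc k ≡ c → h k ≈ 0#) → h c ≈ 0# → h (suc c) ≈ 0# →
                   neighbourSum c h ≈ 0#
  neighbourSum≈0 c h h₋≈0 h₀≈0 h₊≈0 =
    trans (+-cong (+-cong (before≈0 c h h₋≈0) h₀≈0) h₊≈0) (trans (+-identityʳ _) (+-identityʳ 0#))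

  neighbourSum≈prev : ∀ c h → h (suc c) ≈ 0# → h (suc (suc c)) ≈ 0# → neighbourSum (suc c) h ≈ h c
  neighbourSum≈prev c h h₀≈0 h₊≈0 =
    trans (+-cong (+-congˡ h₀≈0) h₊≈0) (trans (+-identityʳ _) (+-identityʳ (h c)))

  neighbourSum≈mid : ∀ c h → (∀ k → suc k ≡ c → h k ≈ 0#) → h (suc c) ≈ 0# → neighbourSum c h ≈ h c
  neighbourSum≈mid c h h₋≈0 h₊≈0 =
    trans (+-cong (+-congʳ (before≈0 c h h₋≈0)) h₊≈0) (trans (+-identityʳ _) (+-identityˡ (h c)))

  neighbourSum≈next : ∀ c h → (∀ k → suc k ≡ c → h k ≈ 0#) → h c ≈ 0# → neighbourSum c h ≈ h (suc c)
  neighbourSum≈next c h h₋≈0 h₀≈0 =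
    trans (+-congʳ (trans (+-cong (before≈0 c h h₋≈0) h₀≈0) (+-identityˡ 0#))) (+-identityˡ (h (suc c)))

  neighbourSum-suc : ∀ c h → (∀ k → suc k < suc c → h k ≈ 0#) →
                     h 0 +ᴿ neighbourSum c (h ∘ suc) ≈ neighbourSum (suc c) h
  neighbourSum-suc zero    h _   = trans (+-congˡ (+-congʳ (+-identityˡ _))) (sym (+-assoc _ _ _))
  neighbourSum-suc (suc c) h low = trans (+-congʳ (low 0 (s≤s (s≤s z≤n)))) (+-identityˡ _)

  ∑-band : ∀ N c h → (∀ k → suc k < c → h k ≈ 0#) → (∀ k → suc c < k → h k ≈ 0#) →
           (∀ k → N ≤ k → h k ≈ 0#) → ∑ N h ≈ neighbourSum c h
  ∑-band zero c h _ _ beyond =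
    sym (neighbourSum≈0 c h (λ k _ → beyond k z≤n) (beyond c z≤n) (beyond (suc c) z≤n))
  ∑-band (suc N) zero h _ high beyond = begin
    h 0 +ᴿ ∑ N (h ∘ suc)
      ≈⟨ +-congˡ (∑-band N 0 (h ∘ suc) (λ _ ()) (λ k → high (suc k) ∘ m<n⇒m<1+n)
                                       (λ k → beyond (suc k) ∘ s≤s)) ⟩
    h 0 +ᴿ neighbourSum 0 (h ∘ suc)
      ≈⟨ +-congˡ (neighbourSum≈mid 0 (h ∘ suc) (λ _ ()) (high 2 ≤-refl)) ⟩
    h 0 +ᴿ h 1
      ≈⟨ +-congʳ (+-identityˡ (h 0)) ⟨
    0# +ᴿ h 0 +ᴿ h 1
      ∎
  ∑-band (suc N) (suc c) h low high beyond = begin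
    h 0 +ᴿ ∑ N (h ∘ suc)
      ≈⟨ +-congˡ (∑-band N c (h ∘ suc) (λ k → low (suc k) ∘ s≤s)
                                       (λ k → high (suc k) ∘ s≤s) (λ k → beyond (suc k) ∘ s≤s)) ⟩
    h 0 +ᴿ neighbourSum c (h ∘ suc)
      ≈⟨ neighbourSum-suc c h low ⟩
    neighbourSum (suc c) h
      ∎

  module Centraliser
    (n ℓ : ℕ) (ℓ<n : ℓ < n) (a y : ℕ → ℕ → Carrier)
    (a-off : ∀ i k → ¬ PathArc (suc ℓ) i k → a i k ≈ 0#)
    (a-on  : ∀ i k → i < n → k < n → PathArc (suc ℓ) i k → ¬ a i k ≈ 0#)
    (y-on  : ∀ i k → PathArc (suc ℓ) k i → y i k ≈ 0#)
    (y-outˡ : ∀ i k → n ≤ i → y i k ≈ 0#)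
    (y-outʳ : ∀ i k → n ≤ k → y i k ≈ 0#)
    (comm : ∀ i j → i < n → j < n → ∑ n (λ k → a i k * y k j) ≈ ∑ n (λ k → y i k * a k j))
    where

    a-far : ∀ i k → suc k < i ⊎ suc i < k → a i k ≈ 0#
    a-far i k far = a-off i k (far⇒¬PathArc far)

    a-super : ∀ i → suc i < n → ¬ a i (suc i) ≈ 0#
    a-super i i+1<n = a-on i (suc i) (<-trans (n<1+n i) i+1<n) i+1<n (inj₁ ≡.refl)

    a-sub : ∀ i → suc i < n → ¬ a (suc i) i ≈ 0#
    a-sub i i+1<n = a-on (suc i) i i+1<n (<-trans (n<1+n i) i+1<n) (inj₂ (inj₁ ≡.refl))

    a-loop : ∀ i → i ≤ ℓ → ¬ a i i ≈ 0#
    a-loop i i≤ℓ = a-on i i i<n i<n (inj₂ (inj₂ (≡.refl , s≤s i≤ℓ)))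
      where
      i<n : i < n
      i<n = ≤-<-trans i≤ℓ ℓ<n

    a-noLoop : ∀ i → ℓ < i → a i i ≈ 0#
    a-noLoop i ℓ<i = a-off i i (¬PathArc-loop ℓ<i)

    y-super : ∀ i → y i (suc i) ≈ 0#
    y-super i = y-on i (suc i) (inj₂ (inj₁ ≡.refl))

    y-loop : ∀ i → i ≤ ℓ → y i i ≈ 0#
    y-loop i i≤ℓ = y-on i i (inj₂ (inj₂ (≡.refl , s≤s i≤ℓ)))

    ay ya : ℕ → ℕ → ℕ → Carrier
    ay i j k = a i k * y k j
    ya i j k = y i k * a k j

    neighbourSum-comm : ∀ i j → i < n → j < n → neighbourSum i (ay i j) ≈ neighbourSum j (ya i j)
    neighbourSum-comm i j i<n j<n = begin
      neighbourSum i (ay i j)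
        ≈⟨ ∑-band n i _ (λ k k+1<i → x≈0⇒x*y≈0 (a-far i k (inj₁ k+1<i)))
                        (λ k i+1<k → x≈0⇒x*y≈0 (a-far i k (inj₂ i+1<k)))
                        (λ k n≤k → y≈0⇒x*y≈0 (y-outˡ k j n≤k)) ⟨
      ∑ n (ay i j)
        ≈⟨ comm i j i<n j<n ⟩
      ∑ n (ya i j)
        ≈⟨ ∑-band n j _ (λ k k+1<j → y≈0⇒x*y≈0 (a-far k j (inj₂ k+1<j)))
                        (λ k j+1<k → y≈0⇒x*y≈0 (a-far k j (inj₁ j+1<k)))
                        (λ k n≤k → x≈0⇒x*y≈0 (y-outʳ i k n≤k)) ⟩
      neighbourSum j (ya i j)
        ∎

    y-OddGap-fuel : ∀ d k j → n ≤ d + k → ℓ ≤ k → OddGap k j → y k j ≈ 0#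
    y-OddGap-fuel zero    k j n≤k _ _ = y-outˡ k j n≤k
    y-OddGap-fuel (suc d) k _ _ _ gap₁ = y-super k
    y-OddGap-fuel (suc d) k _ n≤d+1+k ℓ≤k (gap₊₂ {j = j} g) with suc (suc j) <? n
    ... | no  j+2≮n = y-outʳ k _ (≮⇒≥ j+2≮n)
    ... | yes j+2<n = x*y≈0⇒y≈0 (a-sub k k+1<n) (begin
      a (suc k) k * y k (suc (suc j))
        ≈⟨ neighbourSum≈prev k (ay (suc k) (suc (suc j)))
             (x≈0⇒x*y≈0 (a-noLoop (suc k) (s≤s ℓ≤k)))
             (y≈0⇒x*y≈0 (lowerRow (n≤1+n (suc k)) (OddGap-suc (OddGap-suc g)))) ⟨
      neighbourSum (suc k) (ay (suc k) (suc (suc j)))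
        ≈⟨ neighbourSum-comm (suc k) (suc (suc j)) k+1<n j+2<n ⟩
      neighbourSum (suc (suc j)) (ya (suc k) (suc (suc j)))
        ≈⟨ neighbourSum≈0 (suc (suc j)) (ya (suc k) (suc (suc j)))
             (λ { _ ≡.refl → x≈0⇒x*y≈0 (lowerRow ≤-refl (OddGap-suc g)) })
             (y≈0⇒x*y≈0 (a-noLoop (suc (suc j)) (m≤n⇒m≤1+n (m≤n⇒m≤1+n ℓ<j))))
             (x≈0⇒x*y≈0 (lowerRow ≤-refl (OddGap-suc (gap₊₂ g)))) ⟩
      0#
        ∎)
      where
      k<j : k < j
      k<j = OddGap⇒< g
      ℓ<j : ℓ < j
      ℓ<j = ≤-<-trans ℓ≤k k<j
      k+1<n : suc k < n
      k+1<n = <-trans (s≤s k<j) (<-trans (n<1+n (suc j)) j+2<n)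
      lowerRow : ∀ {k′ j′} → k < k′ → OddGap k′ j′ → y k′ j′ ≈ 0#
      lowerRow k<k′ = y-OddGap-fuel d _ _
        (≤-trans n≤d+1+k (≤-trans (≤-reflexive (≡.sym (+-suc d k))) (+-monoʳ-≤ d k<k′)))
        (≤-trans ℓ≤k (<⇒≤ k<k′))

    y-OddGap : ∀ k j → ℓ ≤ k → OddGap k j → y k j ≈ 0#
    y-OddGap k j = y-OddGap-fuel n k j (m≤m+n n k)

    TriangleZero : ℕ → Set
    TriangleZero s = ∀ i j → i + j < s → y i j ≈ 0#

    module Antidiagonal {s} (Z : TriangleZero s) (s<n : s < n) where

      step : ∀ i j → suc (i + j) ≡ s → y (suc i) j ≈ 0# ⇔ y i (suc j) ≈ 0#
      step i j e = mk⇔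
        (λ z → x*y≈0⇒x≈0 (a-sub j j+1<n) (trans (sym ay≈ya) (y≈0⇒x*y≈0 z)))
        (λ z → x*y≈0⇒y≈0 (a-super i i+1<n) (trans ay≈ya (x≈0⇒x*y≈0 z)))
        where
        i+j<s : i + j < s
        i+j<s = ≤-reflexive e
        i+j<n : suc (i + j) < n
        i+j<n = ≤-<-trans i+j<s s<n
        i+1<n : suc i < n
        i+1<n = ≤-<-trans (s≤s (m≤m+n i j)) i+j<n
        j+1<n : suc j < n
        j+1<n = ≤-<-trans (s≤s (m≤n+m j i)) i+j<n
        ay≈ya : a i (suc i) * y (suc i) j ≈ y i (suc j) * a (suc j) j
        ay≈ya = begin
          a i (suc i) * y (suc i) j
            ≈⟨ neighbourSum≈next i (ay i j)
                 (λ c e′ → y≈0⇒x*y≈0 (Z c j (<-trans (+-monoˡ-< j (≤-reflexive e′)) i+j<s)))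
                 (y≈0⇒x*y≈0 (Z i j i+j<s)) ⟨
          neighbourSum i (ay i j)
            ≈⟨ neighbourSum-comm i j (<-trans (n<1+n i) i+1<n) (<-trans (n<1+n j) j+1<n) ⟩
          neighbourSum j (ya i j)
            ≈⟨ neighbourSum≈next j (ya i j)
                 (λ c e′ → x≈0⇒x*y≈0 (Z i c (<-trans (+-monoʳ-< i (≤-reflexive e′)) i+j<s)))
                 (x≈0⇒x*y≈0 (Z i j i+j<s)) ⟩
          y i (suc j) * a (suc j) j
            ∎

      toTop : ∀ i j → i + j ≡ s → y i j ≈ 0# → y 0 s ≈ 0#
      toTop zero    j e z = ≡.subst (λ j → y 0 j ≈ 0#) e z
      toTop (suc i) j e z =
        toTop i (suc j) (≡.trans (+-suc i j) e) (Equivalence.to (step i j e) z)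

      fromTop : ∀ i j → i + j ≡ s → y 0 s ≈ 0# → y i j ≈ 0#
      fromTop zero    j e z = ≡.subst (λ j → y 0 j ≈ 0#) (≡.sym e) z
      fromTop (suc i) j e z =
        Equivalence.from (step i j e) (fromTop i (suc j) (≡.trans (+-suc i j) e) z)

      lastLoopRow≈0 : ∀ q → ℓ + q ≡ s → OddGap (suc ℓ) q → y ℓ q ≈ 0#
      lastLoopRow≈0 q e g = x*y≈0⇒y≈0 (a-loop ℓ ≤-refl) (begin
        a ℓ ℓ * y ℓ q
          ≈⟨ neighbourSum≈mid ℓ (ay ℓ q)
               (λ c e′ → y≈0⇒x*y≈0 (Z c q (<-≤-trans (+-monoˡ-< q (≤-reflexive e′)) (≤-reflexive e))))
               (y≈0⇒x*y≈0 (y-OddGap (suc ℓ) q (n≤1+n ℓ) g)) ⟨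
        neighbourSum ℓ (ay ℓ q)
          ≈⟨ neighbourSum-comm ℓ q ℓ<n q<n ⟩
        neighbourSum q (ya ℓ q)
          ≈⟨ neighbourSum≈0 q (ya ℓ q)
               (λ c e′ → x≈0⇒x*y≈0 (Z ℓ c (<-≤-trans (+-monoʳ-< ℓ (≤-reflexive e′)) (≤-reflexive e))))
               (y≈0⇒x*y≈0 (a-noLoop q (<-trans (n<1+n ℓ) (OddGap⇒< g))))
               (x≈0⇒x*y≈0 (y-OddGap ℓ (suc q) ≤-refl (OddGap-sucˡ⇒sucʳ g))) ⟩
        0#
          ∎)
        where
        q<n : q < n
        q<n = ≤-<-trans (m≤n+m q ℓ) (≤-<-trans (≤-reflexive e) s<n)

      anchor : ∃₂ λ i j → i + j ≡ s × y i j ≈ 0#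
      anchor with halve s
      ... | k , inj₂ e = k , suc k , ≡.trans (+-suc k k) e , y-super k
      ... | k , inj₁ e with k ≤? ℓ
      ...   | yes k≤ℓ = k , k , e , y-loop k k≤ℓ
      ...   | no  k≰ℓ with even-split-OddGap ℓ k (≰⇒> k≰ℓ)
      ...     | q , ℓ+q≡k+k , g =
        let ℓ+q≡s = ≡.trans ℓ+q≡k+k e in ℓ , q , ℓ+q≡s , lastLoopRow≈0 q ℓ+q≡s g

      all-zero : ∀ i j → i + j ≡ s → y i j ≈ 0#
      all-zero i j e =
        let i₀ , j₀ , e₀ , z₀ = anchor in fromTop i j e (toTop i₀ j₀ e₀ z₀)

    triangle : ∀ s → s ≤ n → TriangleZero s
    triangle zero    _   _ _ ()
    triangle (suc s) s<n i j (s≤s i+j≤s) with m≤n⇒m<n∨m≡n i+j≤s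
    ... | inj₁ i+j<s = triangle s (<⇒≤ s<n) i j i+j<s
    ... | inj₂ i+j≡s = Antidiagonal.all-zero (triangle s (<⇒≤ s<n)) s<n i j i+j≡s

    Row : ℕ → Set
    Row i = ∀ j → y i j ≈ 0#

    row₀ : Row 0
    row₀ j with j <? n
    ... | yes j<n = triangle n ≤-refl 0 j j<n
    ... | no  j≮n = y-outʳ 0 j (≮⇒≥ j≮n)

    row-suc : ∀ i → (∀ c → suc c ≡ i → Row c) → Row i → Row (suc i)
    row-suc i prev cur j with suc i <? n | j <? n
    ... | no  i+1≮n | _        = y-outˡ (suc i) j (≮⇒≥ i+1≮n)
    ... | yes _     | no  j≮n  = y-outʳ (suc i) j (≮⇒≥ j≮n)
    ... | yes i+1<n | yes j<n = x*y≈0⇒y≈0 (a-super i i+1<n) (begin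
      a i (suc i) * y (suc i) j
        ≈⟨ neighbourSum≈next i (ay i j) (λ c e → y≈0⇒x*y≈0 (prev c e j)) (y≈0⇒x*y≈0 (cur j)) ⟨
      neighbourSum i (ay i j)
        ≈⟨ neighbourSum-comm i j (<-trans (n<1+n i) i+1<n) j<n ⟩
      neighbourSum j (ya i j)
        ≈⟨ neighbourSum≈0 j (ya i j) (λ c _ → x≈0⇒x*y≈0 (cur c))
             (x≈0⇒x*y≈0 (cur j)) (x≈0⇒x*y≈0 (cur (suc j))) ⟩
      0#
        ∎)

    rows : ∀ i → Row i × Row (suc i)
    rows zero    = row₀ , row-suc 0 (λ _ ()) row₀
    rows (suc i) =
      let rᵢ , rᵢ₊₁ = rows i in rᵢ₊₁ , row-suc (suc i) (λ { _ ≡.refl → rᵢ }) rᵢ₊₁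

    y≈0 : ∀ i j → y i j ≈ 0#
    y≈0 i = proj₁ (rows i)

  extend : ∀ n → (Fin n → Carrier) → ℕ → Carrier
  extend zero    f k       = 0#
  extend (suc n) f zero    = f Fin.zero
  extend (suc n) f (suc k) = extend n (f ∘ Fin.suc) k

  extend-toℕ : ∀ n (f : Fin n → Carrier) p → extend n f (toℕ p) ≡ f p
  extend-toℕ (suc n) f Fin.zero    = ≡.refl
  extend-toℕ (suc n) f (Fin.suc p) = extend-toℕ n (f ∘ Fin.suc) p

  extend-≈0 : ∀ n (f : Fin n → Carrier) k → (∀ p → toℕ p ≡ k → f p ≈ 0#) → extend n f k ≈ 0#
  extend-≈0 zero    f k       _   = ≈-refl
  extend-≈0 (suc n) f zero    f≈0 = f≈0 Fin.zero ≡.refl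
  extend-≈0 (suc n) f (suc k) f≈0 = extend-≈0 n (f ∘ Fin.suc) k (λ p → f≈0 (Fin.suc p) ∘ ≡.cong suc)

  pad : ∀ {n} → Matrix ℝ n → ℕ → ℕ → Carrier
  pad {n} M i k = extend n (λ p → extend n (M p) k) i

  pad-toℕ : ∀ {n} (M : Matrix ℝ n) p q → pad M (toℕ p) (toℕ q) ≡ M p q
  pad-toℕ {n} M p q = ≡.trans (extend-toℕ n _ p) (extend-toℕ n (M p) q)

  pad-≈0 : ∀ {n} (M : Matrix ℝ n) i k → (∀ p q → toℕ p ≡ i → toℕ q ≡ k → M p q ≈ 0#) → pad M i k ≈ 0#
  pad-≈0 {n} M i k M≈0 = extend-≈0 n _ i (λ p eᵢ → extend-≈0 n (M p) k (λ q eₖ → M≈0 p q eᵢ eₖ))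

  pad-outˡ : ∀ {n} (M : Matrix ℝ n) i k → n ≤ i → pad M i k ≈ 0#
  pad-outˡ M i k n≤i = pad-≈0 M i k λ p _ eᵢ _ →
    ⊥-elim (<⇒≱ (toℕ<n p) (≤-trans n≤i (≤-reflexive (≡.sym eᵢ))))

  pad-outʳ : ∀ {n} (M : Matrix ℝ n) i k → n ≤ k → pad M i k ≈ 0#
  pad-outʳ M i k n≤k = pad-≈0 M i k λ _ q _ eₖ →
    ⊥-elim (<⇒≱ (toℕ<n q) (≤-trans n≤k (≤-reflexive (≡.sym eₖ))))

  fromFin² : ∀ {n} (P : ℕ → ℕ → Set) → (∀ (p q : Fin n) → P (toℕ p) (toℕ q)) →
             ∀ i k → i < n → k < n → P i k
  fromFin² P P-Fin i k i<n k<n =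
    ≡.subst₂ P (toℕ-fromℕ< i<n) (toℕ-fromℕ< k<n) (P-Fin (fromℕ< i<n) (fromℕ< k<n))

  module _ {n} (R : ℕ → ℕ → Set) {A : Matrix ℝ n} (A∈M : InM ℝ (λ p q → R (toℕ p) (toℕ q)) A) where

    pad-off : ∀ i k → ¬ R i k → pad A i k ≈ 0#
    pad-off i k ¬R = pad-≈0 A i k λ p q eᵢ eₖ →
      ≈0-stable (A p q) (λ A≉0 → ¬R (≡.subst₂ R eᵢ eₖ (proj₁ (A∈M p q) A≉0)))

    pad-on : ∀ i k → i < n → k < n → R i k → ¬ pad A i k ≈ 0#
    pad-on = fromFin² (λ i k → R i k → ¬ pad A i k ≈ 0#)
      (λ p q r → proj₂ (A∈M p q) r ∘ ≡.subst (_≈ 0#) (pad-toℕ A p q))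

    pad-annihilatedᵀ : ∀ {X : Matrix ℝ n} → (∀ p q → A p q * X p q ≈ 0#) →
                       ∀ i k → R k i → pad (flip X) i k ≈ 0#
    pad-annihilatedᵀ A∘X≈0 i k r = pad-≈0 _ i k λ p q eᵢ eₖ →
      x*y≈0⇒y≈0 (proj₂ (A∈M q p) (≡.subst₂ R (≡.sym eₖ) (≡.sym eᵢ) r)) (A∘X≈0 q p)

  pad-comm : ∀ {n} (A X : Matrix ℝ n) →
             (∀ p q → sumFin ℝ n (λ k → A p k * X q k) ≈ sumFin ℝ n (λ k → X k p * A k q)) →
             ∀ i j → i < n → j < n →
             ∑ n (λ k → pad A i k * pad (flip X) k j) ≈ ∑ n (λ k → pad (flip X) i k * pad A k j)
  pad-comm {n} A X comm = fromFin² _ λ p q → begin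
    ∑ n (λ k → pad A (toℕ p) k * pad (flip X) k (toℕ q))
      ≈⟨ sumFin-cong n (λ k → *-cong (reflexive (pad-toℕ A p k)) (reflexive (pad-toℕ (flip X) k q))) ⟩
    sumFin ℝ n (λ k → A p k * X q k)
      ≈⟨ comm p q ⟩
    sumFin ℝ n (λ k → X k p * A k q)
      ≈⟨ sumFin-cong n (λ k → *-cong (reflexive (pad-toℕ (flip X) p k)) (reflexive (pad-toℕ A k q))) ⟨
    ∑ n (λ k → pad (flip X) (toℕ p) k * pad A k (toℕ q))
      ∎

theorem5p5 : (ℝ : RealField) (n m : ℕ) → 1 ≤ m → m ≤ n →
    (A : Matrix ℝ n) → InM ℝ (DoublePathArc m) A → nSSP ℝ A
theorem5p5 ℝ n (suc ℓ) (s≤s z≤n) ℓ<n A A∈M X A∘X≈0 AXᵀ≈XᵀA p q =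
  ≈-trans (≈-reflexive (≡.sym (pad-toℕ ℝ (flip X) q p))) (y≈0 (toℕ q) (toℕ p))
  where
  open IsCommutativeRing (RealField.isCommutativeRing ℝ) using ()
    renaming (trans to ≈-trans; reflexive to ≈-reflexive)
  open Centraliser ℝ n ℓ ℓ<n (pad ℝ A) (pad ℝ (flip X))
    (pad-off ℝ (PathArc (suc ℓ)) A∈M) (pad-on ℝ (PathArc (suc ℓ)) A∈M)
    (pad-annihilatedᵀ ℝ (PathArc (suc ℓ)) A∈M A∘X≈0)
    (pad-outˡ ℝ (flip X)) (pad-outʳ ℝ (flip X)) (pad-comm ℝ A X AXᵀ≈XᵀA)
    using (y≈0)
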